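{- There exists an absolute constant $C>0$ such that for all positive integers $n\ge 3$ and all positive integers $r,s$ with $r>s>r/2$, $$A_3(n;r,s)\le n^{C\binom{r}{s}^2\log\binom{r}{s}}.$$
   Context: For a natural number $N$, $[N]=\{1,\dots,N\}$ and $[N]^{(k)}$ denotes the set of $k$-element subsets of $[N]$. A tight monotone path of length $n$ (on $n$ edges) in a $k$-uniform hypergraph on vertex set $[N]$ is determined by vertices $v_1<v_2<\dots<v_{n+k-1}$ in $[N]$ and consists of the $n$ edges $\{v_i,v_{i+1},\dots,v_{i+k-1}\}$, $1\le i\le n$. For positive integers $n\ge k$ and $r>s$, $A_k(n;r,s)$ is the least $N$ such that every coloring of $[N]^{(k)}$ with $r$ colors contains a tight monotone path on $n$ edges whose edges use at most $s$ distinct colors. -}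

module Defs where

open import Data.Nat using (ℕ; zero; suc; _+_; _*_; _∸_; _≤_; _<_)
open import Data.Fin using (Fin; toℕ)
open import Data.Vec using (Vec; tabulate)
open import Data.List using (List; length)
open import Data.List.Membership.Propositional using (_∈_)
open import Data.Product using (Σ; _×_)

-- A k-subset
-- {a₁ < … < a_k} is represented by the increasing vector (a₁,…,a_k);
-- the colouring is only ever evaluated on increasing vectors with
-- entries in [N], so any function on vectors is (an extension of) a
-- colouring of [N]^(k), and every colouring extends to such a function.
Colouring : (k r : ℕ) → Set
Colouring k r = Vec ℕ k → Fin r

IncreasingIn : (N m : ℕ) → (ℕ → ℕ) → Set
IncreasingIn N m v =
  ((i : ℕ) → i < m → 1 ≤ v i × v i ≤ N) ×
  ((i : ℕ) → suc i < m → v i < v (suc i))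

edge : (k : ℕ) → (ℕ → ℕ) → ℕ → Vec ℕ k
edge k v i = tabulate (λ (j : Fin k) → v (i + toℕ j))

HasPathFewColours : (N k r n s : ℕ) → Colouring k r → Set
HasPathFewColours N k r n s c =
  Σ (ℕ → ℕ) λ v →
    IncreasingIn N (n + k ∸ 1) v ×
    Σ (List (Fin r)) λ L →
      length L ≤ s × ((i : ℕ) → i < n → c (edge k v i) ∈ L)

ArrowsPath : (N k n r s : ℕ) → Set
ArrowsPath N k n r s = (c : Colouring k r) → HasPathFewColours N k r n s c

-- "A_k(n;r,s) ≤ B": since A_k(n;r,s) is the least N with ArrowsPath,
-- A_k(n;r,s) ≤ B iff some N ≤ B has the property.
A≤ : (k n r s B : ℕ) → Set
A≤ k n r s B = Σ ℕ λ N → N ≤ B × ArrowsPath N k n r s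

{-# OPTIONS --safe #-}
module Submission where

-- Since s ≥ 2, it suffices to find a monotone tight path on n edges using two colours.
-- Label each vertex k by the function sending a pair of colours (a, b) to the length,
-- capped at n − 1, of the longest {a,b}-coloured monotone tight path starting k, k+1.
-- There are n^(r²) labels, so among n^(r²) + 1 vertices two, k < k', share a label.
-- Taking a, b to be the colours of {k, k+1, k'} and {k+1, k', k'+1}, every
-- {a,b}-path starting k', k'+1 extends to a longer one starting k, k+1; equal capped
-- lengths then force the cap, i.e. a path on n edges.  Finally
-- n^(r²) + 2 ≤ n^(2·C(r,s)²·log C(r,s)) because r ≤ C(r,s).

open import Defs
open import Data.Nat using (ℕ; _+_; _*_; _^_; _≤_; _<_)
open import Data.Nat.Combinatorics using (_C_)
open import Data.Nat.Logarithm using (⌊log₂_⌋)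
open import Data.Product using (Σ; _×_)

open import Function using (_∘_)
open import Data.Nat using (zero; suc; _∸_; z≤n; s≤s; s≤s⁻¹; _<?_)
open import Data.Nat.Properties
open import Data.Nat.Combinatorics using (nC1≡n; nCk+nC[k+1]≡[n+1]C[k+1])
open import Data.Nat.Logarithm using (⌊log₂⌋-mono-≤; ⌊log₂[2^n]⌋≡n)
open import Data.Product using (_,_; ∃; ∃₂)
open import Data.Sum using (inj₁; inj₂)
open import Data.Unit using (⊤; tt)
open import Data.Fin as Fin using (Fin; toℕ; fromℕ<; funToFin; finToFun)
open import Data.Fin.Properties
  using (pigeonhole; toℕ<n; finToFun-funToFin; fromℕ<-injective) renaming (_≟_ to _≟ᶠ_)
open import Data.Vec using ([]; _∷_)
open import Data.List using (List; []; _∷_; length)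
open import Data.List.Relation.Unary.Any using (here; there)
open import Data.List.Membership.Propositional using (_∈_)
open import Relation.Nullary using (Dec; yes; no; _×-dec_; contradiction)
open import Relation.Unary using (Pred; Decidable)
open import Relation.Binary.PropositionalEquality
  using (_≡_; _≗_; refl; sym; cong; subst; module ≡-Reasoning)

module _ {p} {P : Pred ℕ p} (P? : Decidable P) where

  greatest : ℕ → ℕ
  greatest zero = zero
  greatest (suc t) with P? (suc t)
  ... | yes _ = suc t
  ... | no  _ = greatest t

  greatest-≤ : ∀ t → greatest t ≤ t
  greatest-≤ zero = z≤n
  greatest-≤ (suc t) with P? (suc t)
  ... | yes _ = ≤-refl
  ... | no  _ = m≤n⇒m≤1+n (greatest-≤ t)

  greatest-satisfies : P 0 → ∀ t → P (greatest t)
  greatest-satisfies P0 zero = P0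
  greatest-satisfies P0 (suc t) with P? (suc t)
  ... | yes P[1+t] = P[1+t]
  ... | no  _      = greatest-satisfies P0 t

  greatest-maximal : ∀ {u t} → u ≤ t → P u → u ≤ greatest t
  greatest-maximal {t = zero} u≤0 _ = u≤0
  greatest-maximal {t = suc t} u≤1+t Pu with P? (suc t)
  ... | yes _ = u≤1+t
  ... | no ¬P[1+t] with m≤n⇒m<n∨m≡n u≤1+t
  ...   | inj₁ u<1+t = greatest-maximal (s≤s⁻¹ u<1+t) Pu
  ...   | inj₂ refl  = contradiction Pu ¬P[1+t]

module _ {p q} {P : Pred ℕ p} {Q : Pred ℕ q} (P? : Decidable P) (Q? : Decidable Q) where

  greatest-≡⇒P[1+t] : Q 0 → (∀ {u} → Q u → P (suc u)) →
                      ∀ t → greatest Q? t ≡ greatest P? t → P (suc t)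
  greatest-≡⇒P[1+t] Q0 Q⇒P t same
    with m≤n⇒m<n∨m≡n (greatest-≤ Q? t) | Q⇒P (greatest-satisfies Q? Q0 t)
  ... | inj₁ g<t | P[1+g] =
    contradiction (subst (_ <_) (sym same) (greatest-maximal P? g<t P[1+g])) (n≮n _)
  ... | inj₂ g≡t | P[1+g] = subst (P ∘ suc) g≡t P[1+g]

edge-3 : ∀ (v : ℕ → ℕ) i → edge 3 v i ≡ v i ∷ v (1 + i) ∷ v (2 + i) ∷ []
edge-3 v i rewrite +-identityʳ i | +-comm i 1 | +-comm i 2 = refl

-- Vertices are 0-based here: vertex x stands for x + 1 ∈ [N].
module TightPaths {r} (c : Colouring 3 r) (N : ℕ) where

  open import Data.List.Membership.DecPropositional (_≟ᶠ_ {r}) using (_∈?_)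

  colour : ℕ → ℕ → ℕ → Fin r
  colour x y z = c (suc x ∷ suc y ∷ suc z ∷ [])

  Path : List (Fin r) → ℕ → ℕ → ℕ → Set
  Path L zero    i j = ⊤
  Path L (suc t) i j = ∃ λ l → l < N × j < l × colour i j l ∈ L × Path L t j l

  path? : ∀ L t i j → Dec (Path L t i j)
  path? L zero    i j = yes tt
  path? L (suc t) i j = anyUpTo? (λ l → j <? l ×-dec colour i j l ∈? L ×-dec path? L t j l) N

  path-shorten : ∀ {L} t {i j} → Path L (suc t) i j → Path L t i j
  path-shorten zero    _                           = tt
  path-shorten (suc t) (l , l<N , j<l , ∈L , path) = l , l<N , j<l , ∈L , path-shorten t path

  vertex : ∀ {L} t {i j} → Path L t i j → ℕ → ℕ
  vertex t       {i}     _                      zero    = i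
  vertex zero    {j = j} _                      (suc _) = j
  vertex (suc t)         (_ , _ , _ , _ , path) (suc x) = vertex t path x

  vertex-increasingIn : ∀ {L} t {i j} (path : Path L t i j) → i < j → j < N →
                        IncreasingIn N (2 + t) (suc ∘ vertex t path)
  vertex-increasingIn {L} t {i} {j} path i<j j<N = bounded t path i<j j<N , increasing t path i<j
    where
    bounded : ∀ t {i j} (path : Path L t i j) → i < j → j < N →
              ∀ x → x < 2 + t → 1 ≤ suc (vertex t path x) × vertex t path x < N
    bounded t       _                          i<j j<N zero          _ = s≤s z≤n , <-trans i<j j<N
    bounded zero    _                          i<j j<N (suc zero)    _ = s≤s z≤n , j<N
    bounded zero    _                          i<j j<N (suc (suc _)) (s≤s (s≤s ()))
    bounded (suc t) (l , l<N , j<l , _ , path) i<j j<N (suc x)       x<3+t =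
      bounded t path j<l l<N x (s≤s⁻¹ x<3+t)
    increasing : ∀ t {i j} (path : Path L t i j) → i < j →
                 ∀ x → suc x < 2 + t → suc (vertex t path x) < suc (vertex t path (suc x))
    increasing zero    _                          i<j zero    _ = s≤s i<j
    increasing (suc t) _                          i<j zero    _ = s≤s i<j
    increasing zero    _                          i<j (suc _) (s≤s (s≤s ()))
    increasing (suc t) (l , l<N , j<l , _ , path) i<j (suc x) 2+x<3+t =
      increasing t path j<l x (s≤s⁻¹ 2+x<3+t)

  vertex-colour : ∀ {L} t {i j} (path : Path L t i j) {x} → x < t →
                  colour (vertex t path x) (vertex t path (1 + x)) (vertex t path (2 + x)) ∈ L
  vertex-colour (suc zero)    (_ , _ , _ , ∈L , _)    {zero}  _       = ∈L
  vertex-colour (suc (suc t)) (_ , _ , _ , ∈L , _)    {zero}  _       = ∈L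
  vertex-colour (suc t)       (_ , _ , _ , _ , path)  {suc x} 1+x<1+t =
    vertex-colour t path (s≤s⁻¹ 1+x<1+t)

  path⇒hasPathFewColours : ∀ {L s} n {i j} → length L ≤ s → i < j → j < N →
                           Path L n i j → HasPathFewColours N 3 r n s c
  path⇒hasPathFewColours {L} n L≤s i<j j<N path = v , increasingIn , L , L≤s , edge∈L
    where
    v : ℕ → ℕ
    v = suc ∘ vertex n path
    increasingIn : IncreasingIn N (n + 3 ∸ 1) v
    increasingIn = subst (λ m → IncreasingIn N m v) (cong (_∸ 1) (+-comm 3 n))
                         (vertex-increasingIn n path i<j j<N)
    edge∈L : ∀ x → x < n → c (edge 3 v x) ∈ L
    edge∈L x x<n = subst (_∈ L) (sym (cong c (edge-3 v x))) (vertex-colour n path x<n)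

  earlier-pair-extends : ∀ {k k'} → k < k' → suc k' < N → ∃₂ λ a b →
    ∀ {t} → Path (a ∷ b ∷ []) t k' (suc k') → Path (a ∷ b ∷ []) (suc t) k (suc k)
  earlier-pair-extends {k} {k'} k<k' 1+k'<N with m≤n⇒m<n∨m≡n k<k'
  ... | inj₂ refl =
    colour k k' (suc k') , colour k k' (suc k') ,
    λ path → suc k' , 1+k'<N , n<1+n k' , here refl , path
  ... | inj₁ 1+k<k' =
    colour k (suc k) k' , colour (suc k) k' (suc k') ,
    λ {t} path → path-shorten (suc t)
      (k' , <-trans (n<1+n k') 1+k'<N , 1+k<k' , here refl ,
       suc k' , 1+k'<N , n<1+n k' , there (here refl) , path)

  longest : Fin r → Fin r → ℕ → ℕ → ℕ → ℕ
  longest a b t i j = greatest (λ u → path? (a ∷ b ∷ []) u i j) t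

  sameLongest⇒path : ∀ t {k k'} → k < k' → suc k' < N →
    (∀ a b → longest a b t k (suc k) ≡ longest a b t k' (suc k')) →
    ∃₂ λ a b → Path (a ∷ b ∷ []) (suc t) k (suc k)
  sameLongest⇒path t {k} {k'} k<k' 1+k'<N same =
    let a , b , extend = earlier-pair-extends k<k' 1+k'<N
    in  a , b , greatest-≡⇒P[1+t] (λ u → path? _ u k (suc k)) (λ u → path? _ u k' (suc k'))
                                  tt extend t (sym (same a b))

funToFin-injective : ∀ {m n} {f g : Fin m → Fin n} → funToFin f ≡ funToFin g → f ≗ g
funToFin-injective {f = f} {g} f≡g x = begin
  f x                    ≡⟨ finToFun-funToFin f x ⟨
  finToFun (funToFin f) x ≡⟨ cong (λ y → finToFun y x) f≡g ⟩
  finToFun (funToFin g) x ≡⟨ finToFun-funToFin g x ⟩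
  g x                    ∎
  where open ≡-Reasoning

pigeonhole-≗₂ : ∀ {a b d n} → (d ^ b) ^ a < n → (f : Fin n → Fin a → Fin b → Fin d) →
                ∃₂ λ i j → i Fin.< j × ∀ x y → f i x y ≡ f j x y
pigeonhole-≗₂ bound f =
  let i , j , i<j , same = pigeonhole bound (λ i → funToFin (λ x → funToFin (f i x)))
  in  i , j , i<j , λ x → funToFin-injective (funToFin-injective same x)

twoColourPath-arrows : ∀ n r s → 2 ≤ s → ArrowsPath (2 + (suc n ^ r) ^ r) 3 (suc n) r s
twoColourPath-arrows n r s 2≤s c =
  let i , j , i<j , same = pigeonhole-≗₂ ≤-refl label
      a , b , path = sameLongest⇒path n i<j (s≤s (toℕ<n j))
                       (λ a b → fromℕ<-injective _ _ _ _ (same a b))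
  in  path⇒hasPathFewColours (suc n) 2≤s (n<1+n _) (s≤s (toℕ<n i)) path
  where
  open TightPaths c (2 + (suc n ^ r) ^ r)
  label : Fin (suc ((suc n ^ r) ^ r)) → Fin r → Fin r → Fin (suc n)
  label k a b = fromℕ< {longest a b n (toℕ k) (suc (toℕ k))} (s≤s (greatest-≤ _ n))

s<r<2s⇒2≤s : ∀ {r s} → s < r → r < 2 * s → 2 ≤ s
s<r<2s⇒2≤s {s = zero}        _                ()
s<r<2s⇒2≤s {s = suc zero}    (s≤s (s≤s _))    (s≤s (s≤s ()))
s<r<2s⇒2≤s {s = suc (suc _)} _                _ = s≤s (s≤s z≤n)

0<nCk : ∀ {n k} → k ≤ n → 0 < n C k
0<nCk {k = zero}          _         = s≤s z≤n
0<nCk {suc n} {suc k} (s≤s k≤n) =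
  subst (0 <_) (nCk+nC[k+1]≡[n+1]C[k+1] n k) (≤-trans (0<nCk k≤n) (m≤m+n _ _))

n≤nCk : ∀ {n k} → 0 < k → k < n → n ≤ n C k
n≤nCk {n}     {suc zero}    _ _             = ≤-reflexive (sym (nC1≡n n))
n≤nCk {suc n} {suc (suc k)} _ (s≤s 2+k≤n) = begin
  suc n                            ≡⟨ +-comm 1 n ⟩
  n + 1                            ≤⟨ +-mono-≤ (n≤nCk (s≤s z≤n) 2+k≤n) (0<nCk 2+k≤n) ⟩
  n C suc k + n C suc (suc k)      ≡⟨ nCk+nC[k+1]≡[n+1]C[k+1] n (suc k) ⟩
  suc n C suc (suc k)              ∎
  where open ≤-Reasoning

2+n^e≤n^[1+e] : ∀ {n} e → 3 ≤ n → 2 + n ^ e ≤ n ^ suc e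
2+n^e≤n^[1+e] {n@(suc _)} e 3≤n = begin
  2 + n ^ e        ≤⟨ +-mono-≤ 1≤n^e (+-mono-≤ 1≤n^e (≤-reflexive (sym (+-identityʳ _)))) ⟩
  3 * n ^ e        ≤⟨ *-monoˡ-≤ (n ^ e) 3≤n ⟩
  n * n ^ e        ∎
  where
  open ≤-Reasoning
  1≤n^e : 1 ≤ n ^ e
  1≤n^e = m^n>0 n e

1+r²≤2m²l : ∀ {r m l} → 1 ≤ r → r ≤ m → 1 ≤ l → suc (r * r) ≤ 2 * (m * m) * l
1+r²≤2m²l {r} {m} {l} 1≤r r≤m 1≤l = begin
  1 + r * r          ≤⟨ +-mono-≤ (*-mono-≤ 1≤m 1≤m) (*-mono-≤ r≤m r≤m) ⟩
  m * m + m * m      ≡⟨ cong (m * m +_) (+-identityʳ (m * m)) ⟨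
  2 * (m * m)        ≡⟨ *-identityʳ (2 * (m * m)) ⟨
  2 * (m * m) * 1    ≤⟨ *-monoʳ-≤ (2 * (m * m)) 1≤l ⟩
  2 * (m * m) * l    ∎
  where
  open ≤-Reasoning
  1≤m : 1 ≤ m
  1≤m = ≤-trans 1≤r r≤m

1≤⌊log₂n⌋ : ∀ {n} → 2 ≤ n → 1 ≤ ⌊log₂ n ⌋
1≤⌊log₂n⌋ {n} 2≤n = subst (_≤ ⌊log₂ n ⌋) (⌊log₂[2^n]⌋≡n 1) (⌊log₂⌋-mono-≤ 2≤n)

size-bound : ∀ {n r s} → 3 ≤ n → s < r → r < 2 * s →
             2 + (n ^ r) ^ r ≤ n ^ (2 * ((r C s) * (r C s)) * ⌊log₂ (r C s) ⌋)
size-bound {n@(suc _)} {r} {s} 3≤n s<r r<2s = begin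
  2 + (n ^ r) ^ r  ≡⟨ cong (2 +_) (^-*-assoc n r r) ⟩
  2 + n ^ (r * r)  ≤⟨ 2+n^e≤n^[1+e] (r * r) 3≤n ⟩
  n ^ suc (r * r)  ≤⟨ ^-monoʳ-≤ n (1+r²≤2m²l 1≤r r≤rCs (1≤⌊log₂n⌋ 2≤rCs)) ⟩
  n ^ (2 * ((r C s) * (r C s)) * ⌊log₂ (r C s) ⌋) ∎
  where
  open ≤-Reasoning
  2≤s : 2 ≤ s
  2≤s = s<r<2s⇒2≤s s<r r<2s
  1≤r : 1 ≤ r
  1≤r = ≤-trans (s≤s z≤n) s<r
  r≤rCs : r ≤ r C s
  r≤rCs = n≤nCk (≤-trans (s≤s z≤n) 2≤s) s<r
  2≤rCs : 2 ≤ r C s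
  2≤rCs = ≤-trans 2≤s (≤-trans (<⇒≤ s<r) r≤rCs)

theorem1p5 : Σ ℕ λ K → 0 < K ×
    ((n r s : ℕ) → 3 ≤ n → 1 ≤ s → s < r → r < 2 * s →
    A≤ 3 n r s (n ^ (K * ((r C s) * (r C s)) * ⌊log₂ (r C s) ⌋)))
theorem1p5 = 2 , s≤s z≤n , λ where
  n@(suc n') r s 3≤n _ s<r r<2s →
    2 + (n ^ r) ^ r , size-bound 3≤n s<r r<2s , twoColourPath-arrows n' r s (s<r<2s⇒2≤s s<r r<2s)
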